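{- For every graph $G$, $\gamma_R(G)+1\leq \gamma_R(\mu(G))\leq \gamma_R(G)+2$.
   Context: All graphs are finite and simple. A Roman dominating function (RDF) of a graph $G=(V,E)$ is a function $f:V\to\{0,1,2\}$ such that every vertex $v$ with $f(v)=0$ has a neighbor $w$ with $f(w)=2$; its weight is $\sum_{v\in V}f(v)$, and $\gamma_R(G)$ is the minimum weight of an RDF of $G$. The Mycielskian $\mu(G)$ of $G$ with $V(G)=\{v_1^0,\ldots,v_n^0\}$ is the graph with vertex set $\{v_1^0,\ldots,v_n^0\}\cup\{v_1^1,\ldots,v_n^1\}\cup\{u\}$ and edge set $E(G)\cup\{v_j^0v_{j'}^1 : v_j^0v_{j'}^0\in E(G)\}\cup\{v_j^1u: 1\leq j\leq n\}$. -}

module Defs where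

open import Data.Nat using (ℕ; zero; suc; _+_)
import Data.Nat
open import Data.Fin using (Fin; zero; suc; toℕ; splitAt)
open import Data.Bool using (Bool; true; false)
open import Data.Sum using (inj₁; inj₂)
open import Data.Product using (Σ; _×_; ∃-syntax)
open import Data.Vec using (sum; tabulate)
open import Relation.Binary.PropositionalEquality using (_≡_; refl)

record Graph : Set where
  field
    n      : ℕ
    adj    : Fin n → Fin n → Bool
    sym    : ∀ x y → adj x y ≡ adj y x
    irrefl : ∀ x → adj x x ≡ false
open Graph public

two : Fin 3
two = suc (suc zero)

weight : (G : Graph) → (Fin (n G) → Fin 3) → ℕ
weight G f = sum (tabulate (λ v → toℕ (f v)))

IsRDF : (G : Graph) → (Fin (n G) → Fin 3) → Set
IsRDF G f = ∀ v → f v ≡ zero → ∃[ w ] (adj G v w ≡ true × f w ≡ two)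

IsRomanDominationNumber : Graph → ℕ → Set
IsRomanDominationNumber G k =
  (∃[ f ] (IsRDF G f × weight G f ≡ k)) ×
  (∀ f → IsRDF G f → k Data.Nat.≤ weight G f)

-- Vertices of the Mycielskian: Fin (suc (n + n)), where
-- zero = u, suc i with i < n is v_i^0, suc (n + j) is v_j^1.
data MVtx (m : ℕ) : Set where
  hub  : MVtx m
  old  : Fin m → MVtx m
  copy : Fin m → MVtx m

classify : ∀ {m} → Fin (suc (m + m)) → MVtx m
classify zero = hub
classify {m} (suc i) with splitAt m i
... | inj₁ j = old j
... | inj₂ j = copy j

madj : ∀ {m} → (Fin m → Fin m → Bool) → MVtx m → MVtx m → Bool
madj a hub      hub       = false
madj a hub      (old _)   = false
madj a hub      (copy _)  = true
madj a (old _)  hub       = false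
madj a (old j)  (old j')  = a j j'
madj a (old j)  (copy j') = a j j'
madj a (copy _) hub       = true
madj a (copy j) (old j')  = a j j'
madj a (copy _) (copy _)  = false

madj-sym : ∀ {m} (a : Fin m → Fin m → Bool) → (∀ x y → a x y ≡ a y x) →
           ∀ x y → madj a x y ≡ madj a y x
madj-sym a s hub      hub       = refl
madj-sym a s hub      (old _)   = refl
madj-sym a s hub      (copy _)  = refl
madj-sym a s (old _)  hub       = refl
madj-sym a s (old j)  (old j')  = s j j'
madj-sym a s (old j)  (copy j') = s j j'
madj-sym a s (copy _) hub       = refl
madj-sym a s (copy j) (old j')  = s j j'
madj-sym a s (copy _) (copy _)  = refl

madj-irrefl : ∀ {m} (a : Fin m → Fin m → Bool) → (∀ x → a x x ≡ false) →
              ∀ x → madj a x x ≡ false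
madj-irrefl a i hub      = refl
madj-irrefl a i (old j)  = i j
madj-irrefl a i (copy j) = refl

mycielskian : Graph → Graph
mycielskian G = record
  { n      = suc (n G + n G)
  ; adj    = λ x y → madj (adj G) (classify x) (classify y)
  ; sym    = λ x y → madj-sym (adj G) (sym G) (classify x) (classify y)
  ; irrefl = λ x → madj-irrefl (adj G) (irrefl G) (classify x)
  }

-- From an RDF f of G: label the old vertices by f, the copies by 0 and the hub u by 2; every
-- copy is then dominated by u, so μ(G) has an RDF of weight w(f) + 2.  Conversely, from an RDF g
-- of μ(G) put f(v) = max (g(v⁰), g(v¹)): v⁰ is adjacent to w⁰ or w¹ only when v is adjacent to w
-- in G, so f is an RDF of G, of weight at most w(g) - g(u).  If g(u) = 0, then u is dominated by
-- some x¹ with g(x¹) = 2, and every copy v¹ labelled 0 is dominated by an old vertex; hence labels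
-- 2 on copies may be lowered to 1 before taking the maximum, which saves a further unit at x.

module Submission where

open import Defs
open import Data.Nat using (ℕ; zero; suc; _+_; _≤_; _<_; z≤n; s≤s)
open import Data.Nat.Properties
  using (+-0-commutativeMonoid; +-assoc; +-comm; +-identityʳ; +-mono-≤; +-mono-<-≤; +-mono-≤-<;
         +-monoˡ-≤; +-monoʳ-≤; ≤-refl; ≤-trans; ≤-reflexive; m≤n+m; m≤m+n; module ≤-Reasoning)
open import Algebra.Properties.CommutativeMonoid.Sum +-0-commutativeMonoid
  using (sum; sum-cong-≗; ∑-distrib-+; sum-replicate-zero)
import Data.Vec as Vec
open import Data.Fin using (Fin; zero; suc; toℕ; splitAt; _↑ˡ_; _↑ʳ_)
open import Data.Fin.Properties using (splitAt-↑ˡ; splitAt-↑ʳ; splitAt⁻¹-↑ˡ; splitAt⁻¹-↑ʳ)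
open import Data.Bool using (Bool; true)
open import Data.Sum using (inj₁; inj₂)
open import Data.Product using (_×_; _,_; ∃-syntax)
open import Function using (_∘_; id)
open import Relation.Binary.PropositionalEquality
  using (_≡_; _≗_; refl; trans; cong; cong₂; subst; subst₂; module ≡-Reasoning)
import Relation.Binary.PropositionalEquality as ≡

sum-tabulate : ∀ {m} (h : Fin m → ℕ) → Vec.sum (Vec.tabulate h) ≡ sum h
sum-tabulate {zero}  h = refl
sum-tabulate {suc m} h = cong (h zero +_) (sum-tabulate (h ∘ suc))

weight≡sum : (G : Graph) (f : Fin (n G) → Fin 3) → weight G f ≡ sum (toℕ ∘ f)
weight≡sum G f = sum-tabulate (toℕ ∘ f)

sum-mono-≤ : ∀ {m} {h h' : Fin m → ℕ} → (∀ i → h i ≤ h' i) → sum h ≤ sum h'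
sum-mono-≤ {zero}  h≤h' = z≤n
sum-mono-≤ {suc m} h≤h' = +-mono-≤ (h≤h' zero) (sum-mono-≤ (h≤h' ∘ suc))

sum-mono-< : ∀ {m} {h h' : Fin m → ℕ} → (∀ i → h i ≤ h' i) →
             ∀ x → h x < h' x → sum h < sum h'
sum-mono-< {suc m} h≤h' zero    hx<h'x = +-mono-<-≤ hx<h'x (sum-mono-≤ (h≤h' ∘ suc))
sum-mono-< {suc m} h≤h' (suc x) hx<h'x = +-mono-≤-< (h≤h' zero) (sum-mono-< (h≤h' ∘ suc) x hx<h'x)

sum-↑ : ∀ m {m'} (h : Fin (m + m') → ℕ) → sum h ≡ sum (h ∘ (_↑ˡ m')) + sum (h ∘ (m ↑ʳ_))
sum-↑ zero    h = refl
sum-↑ (suc m) h = trans (cong (h zero +_) (sum-↑ m (h ∘ suc))) (≡.sym (+-assoc (h zero) _ _))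

one : Fin 3
one = suc zero

_⊔_ : Fin 3 → Fin 3 → Fin 3
zero           ⊔ q     = q
suc zero       ⊔ zero  = one
suc zero       ⊔ suc q = suc q
suc (suc zero) ⊔ _     = two

⊔-≤-+ : ∀ p q → toℕ (p ⊔ q) ≤ toℕ p + toℕ q
⊔-≤-+ zero             q       = ≤-refl
⊔-≤-+ (suc zero)       zero    = ≤-refl
⊔-≤-+ (suc zero)       (suc q) = m≤n+m (toℕ (suc q)) 1
⊔-≤-+ (suc (suc zero)) q       = m≤m+n 2 (toℕ q)

⊔-conicalˡ : ∀ p q → p ⊔ q ≡ zero → p ≡ zero
⊔-conicalˡ zero             q       _  = refl
⊔-conicalˡ (suc zero)       zero    ()
⊔-conicalˡ (suc zero)       (suc q) ()
⊔-conicalˡ (suc (suc zero)) q       ()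

⊔-conicalʳ : ∀ p q → p ⊔ q ≡ zero → q ≡ zero
⊔-conicalʳ zero    q p⊔q≡0 = p⊔q≡0
⊔-conicalʳ (suc p) q p⊔q≡0 with () ← ⊔-conicalˡ (suc p) q p⊔q≡0

p⊔two≡two : ∀ p → p ⊔ two ≡ two
p⊔two≡two zero             = refl
p⊔two≡two (suc zero)       = refl
p⊔two≡two (suc (suc zero)) = refl

cap : Fin 3 → Fin 3
cap (suc (suc zero)) = one
cap p                = p

cap-conical : ∀ p → cap p ≡ zero → p ≡ zero
cap-conical zero             _  = refl
cap-conical (suc zero)       ()
cap-conical (suc (suc zero)) ()

cap-≤ : ∀ p → toℕ (cap p) ≤ toℕ p
cap-≤ zero             = ≤-refl
cap-≤ (suc zero)       = ≤-refl
cap-≤ (suc (suc zero)) = s≤s z≤n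

cap-<-two : ∀ {p} → p ≡ two → toℕ (cap p) < toℕ p
cap-<-two refl = ≤-refl

RomanDominating : {V : Set} → (V → V → Bool) → (V → Fin 3) → Set
RomanDominating E f = ∀ v → f v ≡ zero → ∃[ w ] (E v w ≡ true × f w ≡ two)

rdf-pullback : {V W : Set} {E : V → V → Bool} {E' : W → W → Bool} {f : V → Fin 3}
               (σ : W → V) (τ : V → W) → (∀ v → σ (τ v) ≡ v) →
               (∀ x y → E (σ x) (σ y) ≡ E' x y) →
               RomanDominating E f → RomanDominating E' (f ∘ σ)
rdf-pullback {E = E} {f = f} σ τ στ≡id E∘σ≡E' rdf x fσx≡0 with rdf (σ x) fσx≡0
... | w , Eσxw , fw≡2 =
  τ w , trans (≡.sym (E∘σ≡E' x (τ w))) (subst (λ z → E (σ x) z ≡ true) (≡.sym (στ≡id w)) Eσxw)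
      , trans (cong f (στ≡id w)) fw≡2

encode : ∀ {m} → MVtx m → Fin (suc (m + m))
encode     hub      = zero
encode {m} (old i)  = suc (i ↑ˡ m)
encode {m} (copy i) = suc (m ↑ʳ i)

classify-encode : ∀ {m} (c : MVtx m) → classify (encode c) ≡ c
classify-encode     hub                               = refl
classify-encode {m} (old i)  rewrite splitAt-↑ˡ m i m = refl
classify-encode {m} (copy i) rewrite splitAt-↑ʳ m m i = refl

encode-classify : ∀ {m} (x : Fin (suc (m + m))) → encode (classify {m} x) ≡ x
encode-classify     zero = refl
encode-classify {m} (suc i) with splitAt m i in eq
... | inj₁ j = cong suc (splitAt⁻¹-↑ˡ {m} eq)
... | inj₂ j = cong suc (splitAt⁻¹-↑ʳ {m} eq)

mweight : ∀ {m} → (MVtx m → Fin 3) → ℕ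
mweight h = toℕ (h hub) + (sum (toℕ ∘ h ∘ old) + sum (toℕ ∘ h ∘ copy))

mweight-cong : ∀ {m} {h h' : MVtx m → Fin 3} → h ≗ h' → mweight h ≡ mweight h'
mweight-cong h≗h' = cong₂ _+_ (cong toℕ (h≗h' hub))
  (cong₂ _+_ (sum-cong-≗ (cong toℕ ∘ h≗h' ∘ old)) (sum-cong-≗ (cong toℕ ∘ h≗h' ∘ copy)))

module _ {m : ℕ} (a : Fin m → Fin m → Bool) where

  extend : (Fin m → Fin 3) → MVtx m → Fin 3
  extend f hub      = two
  extend f (old i)  = f i
  extend f (copy i) = zero

  extend-rdf : {f : Fin m → Fin 3} → RomanDominating a f → RomanDominating (madj a) (extend f)
  extend-rdf rdf hub      ()
  extend-rdf rdf (old i)  fi≡0 with rdf i fi≡0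
  ... | w , aiw , fw≡2 = old w , aiw , fw≡2
  extend-rdf rdf (copy i) _    = hub , refl , refl

  mweight-extend : (f : Fin m → Fin 3) → mweight (extend f) ≡ sum (toℕ ∘ f) + 2
  mweight-extend f = begin
    2 + (sum (toℕ ∘ f) + sum {m} (λ _ → 0)) ≡⟨ cong (λ s → 2 + (sum (toℕ ∘ f) + s)) (sum-replicate-zero m) ⟩
    2 + (sum (toℕ ∘ f) + 0)                 ≡⟨ cong (2 +_) (+-identityʳ _) ⟩
    2 + sum (toℕ ∘ f)                       ≡⟨ +-comm 2 _ ⟩
    sum (toℕ ∘ f) + 2                       ∎
    where open ≡-Reasoning

  collapse : (Fin 3 → Fin 3) → (MVtx m → Fin 3) → Fin m → Fin 3
  collapse c h v = h (old v) ⊔ c (h (copy v))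

  collapse-weight : (c : Fin 3 → Fin 3) (h : MVtx m → Fin 3) →
                    sum (toℕ ∘ collapse c h) ≤ sum (toℕ ∘ h ∘ old) + sum (toℕ ∘ c ∘ h ∘ copy)
  collapse-weight c h = ≤-trans (sum-mono-≤ (λ v → ⊔-≤-+ (h (old v)) (c (h (copy v)))))
                                (≤-reflexive (∑-distrib-+ (toℕ ∘ h ∘ old) (toℕ ∘ c ∘ h ∘ copy)))

  collapse-id-rdf : {h : MVtx m → Fin 3} → RomanDominating (madj a) h → RomanDominating a (collapse id h)
  collapse-id-rdf {h} rdf v fv≡0 with rdf (old v) (⊔-conicalˡ (h (old v)) (h (copy v)) fv≡0)
  ... | old w  , avw , hw≡2 = w , avw , cong (_⊔ h (copy w)) hw≡2
  ... | copy w , avw , hw≡2 = w , avw , trans (cong (h (old w) ⊔_) hw≡2) (p⊔two≡two (h (old w)))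

  collapse-cap-rdf : {h : MVtx m → Fin 3} → RomanDominating (madj a) h → h hub ≡ zero →
                     RomanDominating a (collapse cap h)
  collapse-cap-rdf {h} rdf hhub≡0 v fv≡0
    with rdf (copy v) (cap-conical (h (copy v)) (⊔-conicalʳ (h (old v)) (cap (h (copy v))) fv≡0))
  ... | old w , avw , hw≡2 = w , avw , cong (_⊔ cap (h (copy w))) hw≡2
  ... | hub   , _   , hw≡2 with () ← trans (≡.sym hhub≡0) hw≡2

  hub-dominator : {h : MVtx m → Fin 3} → RomanDominating (madj a) h → h hub ≡ zero →
                  ∃[ x ] h (copy x) ≡ two
  hub-dominator rdf hhub≡0 with rdf hub hhub≡0
  ... | copy x , _ , hx≡2 = x , hx≡2

  collapse-rdf : {h : MVtx m → Fin 3} → RomanDominating (madj a) h →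
                 ∃[ f ] (RomanDominating a f × sum (toℕ ∘ f) + 1 ≤ mweight h)
  collapse-rdf {h} rdf with h hub in hhub
  ... | suc t = collapse id h , collapse-id-rdf rdf , (begin
    sum (toℕ ∘ collapse id h) + 1 ≤⟨ +-monoˡ-≤ 1 (collapse-weight id h) ⟩
    Σold + Σcopy + 1             ≡⟨ +-comm (Σold + Σcopy) 1 ⟩
    suc (Σold + Σcopy)           ≤⟨ s≤s (m≤n+m (Σold + Σcopy) (toℕ t)) ⟩
    toℕ (suc t) + (Σold + Σcopy) ∎)
    where
    open ≤-Reasoning
    Σold = sum (toℕ ∘ h ∘ old)
    Σcopy = sum (toℕ ∘ h ∘ copy)
  ... | zero with hub-dominator rdf hhub
  ...   | x , hx≡2 = collapse cap h , collapse-cap-rdf rdf hhub , (begin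
    sum (toℕ ∘ collapse cap h) + 1   ≤⟨ +-monoˡ-≤ 1 (collapse-weight cap h) ⟩
    Σold + Σcap + 1                  ≡⟨ +-assoc Σold Σcap 1 ⟩
    Σold + (Σcap + 1)                ≤⟨ +-monoʳ-≤ Σold (≤-reflexive (+-comm Σcap 1)) ⟩
    Σold + suc Σcap                  ≤⟨ +-monoʳ-≤ Σold Σcap<Σcopy ⟩
    Σold + Σcopy                     ∎)
    where
    open ≤-Reasoning
    Σold = sum (toℕ ∘ h ∘ old)
    Σcap = sum (toℕ ∘ cap ∘ h ∘ copy)
    Σcopy = sum (toℕ ∘ h ∘ copy)
    Σcap<Σcopy : Σcap < Σcopy
    Σcap<Σcopy = sum-mono-< (cap-≤ ∘ h ∘ copy) x (cap-<-two hx≡2)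

module _ (G : Graph) where
  private
    μ = mycielskian G

  weight-mycielskian : (g : Fin (n μ) → Fin 3) → weight μ g ≡ mweight (g ∘ encode {n G})
  weight-mycielskian g = cong (toℕ (g zero) +_)
    (trans (sum-tabulate (toℕ ∘ g ∘ suc)) (sum-↑ (n G) (toℕ ∘ g ∘ suc)))

  weight-mycielskian-classify : (h : MVtx (n G) → Fin 3) → weight μ (h ∘ classify {n G}) ≡ mweight h
  weight-mycielskian-classify h =
    trans (weight-mycielskian (h ∘ classify)) (mweight-cong (cong h ∘ classify-encode))

  rdf-mycielskian-classify : {h : MVtx (n G) → Fin 3} →
                             RomanDominating (madj (adj G)) h → IsRDF μ (h ∘ classify)
  rdf-mycielskian-classify = rdf-pullback classify (encode {n G}) classify-encode (λ _ _ → refl)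

  rdf-mycielskian-encode : {g : Fin (n μ) → Fin 3} →
                           IsRDF μ g → RomanDominating (madj (adj G)) (g ∘ encode)
  rdf-mycielskian-encode = rdf-pullback encode (classify {n G}) encode-classify
    (λ c c' → cong₂ (madj (adj G)) (classify-encode c) (classify-encode c'))

  rdf-to-mycielskian : {f : Fin (n G) → Fin 3} → IsRDF G f →
                       ∃[ g ] (IsRDF μ g × weight μ g ≡ weight G f + 2)
  rdf-to-mycielskian {f} rdf = extend (adj G) f ∘ classify
    , rdf-mycielskian-classify (extend-rdf (adj G) rdf)
    , trans (weight-mycielskian-classify (extend (adj G) f))
            (trans (mweight-extend (adj G) f) (cong (_+ 2) (≡.sym (weight≡sum G f))))

  rdf-from-mycielskian : {g : Fin (n μ) → Fin 3} → IsRDF μ g →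
                         ∃[ f ] (IsRDF G f × weight G f + 1 ≤ weight μ g)
  rdf-from-mycielskian {g} rdg with collapse-rdf (adj G) (rdf-mycielskian-encode rdg)
  ... | f , rdf , f+1≤ = f , rdf ,
    subst₂ (λ l r → l + 1 ≤ r) (≡.sym (weight≡sum G f)) (≡.sym (weight-mycielskian g)) f+1≤

theorem1 : (G : Graph) (k k' : ℕ) →
           IsRomanDominationNumber G k →
           IsRomanDominationNumber (mycielskian G) k' →
           (k + 1 ≤ k') × (k' ≤ k + 2)
theorem1 G k k' ((f , rdf , wf≡k) , minG) ((g , rdg , wg≡k') , minμ) = lower , upper
  where
  lower : k + 1 ≤ k'
  lower with rdf-from-mycielskian G rdg
  ... | f₀ , rdf₀ , wf₀+1≤wg = subst (k + 1 ≤_) wg≡k' (≤-trans (+-monoˡ-≤ 1 (minG f₀ rdf₀)) wf₀+1≤wg)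
  upper : k' ≤ k + 2
  upper with rdf-to-mycielskian G rdf
  ... | g₀ , rdg₀ , wg₀≡wf+2 = subst (λ w → k' ≤ w + 2) wf≡k (subst (k' ≤_) wg₀≡wf+2 (minμ g₀ rdg₀))
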